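{- Let $\overrightarrow{G}$ and $\overrightarrow{G}'$ be two associated oriented graphs obtained from a bipartite signed graph $(G,\sigma)$ (possibly using different bipartitions). Then $\overrightarrow{G}$ is push equivalent to $\overrightarrow{G}'$.
   Context: A signed graph $(G,\sigma)$ is a graph with $\sigma:E(G)\to\{+,-\}$. Given a bipartite signed graph and a bipartition $V(G)=A\cup B$ into independent sets, its associated oriented graph has the same vertices, each positive edge $uv$ ($u\in A,v\in B$) becomes the arc $uv$ and each negative edge becomes the arc $vu$. To push a vertex of an oriented graph is to reverse all arcs incident to it; pushing a set pushes each vertex once; push equivalent means obtainable from each other by pushing a vertex set. -}

module Defs where

open import Data.Nat using (ℕ)
open import Data.Fin using (Fin)
open import Data.Bool using (Bool; true; false; _xor_; if_then_else_; _∧_; _∨_; not)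
open import Data.Maybe using (Maybe; just; nothing)
open import Relation.Binary.PropositionalEquality using (_≡_; _≢_)
open import Data.Product using (∃)

data Sign : Set where
  pos neg : Sign

record SignedGraph (n : ℕ) : Set where
  field
    sgn   : Fin n → Fin n → Maybe Sign
    symm  : ∀ u v → sgn u v ≡ sgn v u
    irrefl : ∀ u → sgn u u ≡ nothing
open SignedGraph public

-- A bipartition V = A ∪ B given by its indicator: side v = true iff v ∈ A.
Bipartition : ℕ → Set
Bipartition n = Fin n → Bool

IsBipartition : ∀ {n} → SignedGraph n → Bipartition n → Set
IsBipartition G side = ∀ u v s → sgn G u v ≡ just s → side u ≢ side v

OrientedGraph : ℕ → Set
OrientedGraph n = Fin n → Fin n → Bool

isPosArc : Maybe Sign → Bool
isPosArc (just pos) = true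
isPosArc _ = false

isNegArc : Maybe Sign → Bool
isNegArc (just neg) = true
isNegArc _ = false

associated : ∀ {n} → SignedGraph n → Bipartition n → OrientedGraph n
associated G side u v =
  (side u ∧ not (side v) ∧ isPosArc (sgn G u v)) ∨
  (not (side u) ∧ side v ∧ isNegArc (sgn G u v))

-- Pushing a vertex set S (indicator) once each: an arc between u and v is
-- reversed iff exactly one of its endpoints lies in S.
push : ∀ {n} → (Fin n → Bool) → OrientedGraph n → OrientedGraph n
push S D u v = if S u xor S v then D v u else D u v

PushEquivalent : ∀ {n} → OrientedGraph n → OrientedGraph n → Set
PushEquivalent {n} D D' = ∃ λ (S : Fin n → Bool) → ∀ u v → push S D u v ≡ D' u v

-- Every edge joins the two sides of both bipartitions, so along an edge either
-- both endpoints switch sides or neither does; hence the two orientations of an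
-- edge disagree exactly when its endpoints switched.  Pushing the vertices that
-- move from A to B' reverses precisely the edges with exactly one such endpoint,
-- and an edge has exactly one such endpoint iff its endpoints switched sides.
module Submission where

open import Defs
open import Data.Fin using (Fin)
open import Data.Bool using (Bool; true; false; _xor_; _∧_; not)
open import Data.Bool.Properties using (¬-not; not-distribˡ-xor; xor-annihilates-not)
open import Data.Maybe using (just; nothing)
open import Data.Product using (_,_)
open import Function using (_∘_)
open import Relation.Binary.PropositionalEquality
open ≡-Reasoning

xor-xor-cancelˡ : ∀ a b c → (a xor b) xor (a xor c) ≡ b xor c
xor-xor-cancelˡ false b c = refl
xor-xor-cancelˡ true  b c = xor-annihilates-not b c

∧-not-xor-∧-not : ∀ {a b a′ b′} → a ≢ b → a′ ≢ b′ →
                  (a ∧ not a′) xor (b ∧ not b′) ≡ a xor a′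
∧-not-xor-∧-not {a} {b} {a′} {b′} a≢b a′≢b′
  rewrite ¬-not a≢b | ¬-not a′≢b′ with b | b′
... | false | false = refl
... | false | true  = refl
... | true  | false = refl
... | true  | true  = refl

push-absent : ∀ {n} (S : Fin n → Bool) (D : OrientedGraph n) {u v} →
              D u v ≡ false → D v u ≡ false → push S D u v ≡ false
push-absent S D {u} {v} uv vu with S u xor S v
... | true  = vu
... | false = uv

push-reverses : ∀ {n} (S : Fin n → Bool) (D : OrientedGraph n) {u v} →
                D v u ≡ not (D u v) → push S D u v ≡ (S u xor S v) xor D u v
push-reverses S D {u} {v} vu with S u xor S v
... | true  = vu
... | false = refl

negative : Sign → Bool
negative pos = false
negative neg = true

module _ {n} (G : SignedGraph n) (side : Bipartition n) where

  associated-nonedge : ∀ {u v} → sgn G u v ≡ nothing → associated G side u v ≡ false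
  associated-nonedge {u} {v} e rewrite e with side u | side v
  ... | false | false = refl
  ... | false | true  = refl
  ... | true  | false = refl
  ... | true  | true  = refl

  associated-edge : ∀ {u v s} → sgn G u v ≡ just s → side u ≢ side v →
                    associated G side u v ≡ side u xor negative s
  associated-edge {u} {v} {s} e u≢v rewrite e | ¬-not u≢v with side v | s
  ... | false | pos = refl
  ... | false | neg = refl
  ... | true  | pos = refl
  ... | true  | neg = refl

  associated-antisym : ∀ {u v s} → sgn G u v ≡ just s → side u ≢ side v →
                       associated G side v u ≡ not (associated G side u v)
  associated-antisym {u} {v} {s} e u≢v = begin
    associated G side v u            ≡⟨ associated-edge (trans (symm G v u) e) (u≢v ∘ sym) ⟩
    side v xor negative s            ≡⟨ cong (_xor negative s) (¬-not (u≢v ∘ sym)) ⟩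
    not (side u) xor negative s      ≡⟨ sym (not-distribˡ-xor (side u) (negative s)) ⟩
    not (side u xor negative s)      ≡⟨ cong not (sym (associated-edge e u≢v)) ⟩
    not (associated G side u v)      ∎

movedAtoB′ : ∀ {n} → Bipartition n → Bipartition n → Fin n → Bool
movedAtoB′ side side′ u = side u ∧ not (side′ u)

push-movedAtoB′-associated : ∀ {n} (G : SignedGraph n) (side side′ : Bipartition n) →
  IsBipartition G side → IsBipartition G side′ →
  ∀ u v → push (movedAtoB′ side side′) (associated G side) u v ≡ associated G side′ u v
push-movedAtoB′-associated G side side′ bip bip′ u v = by-sign (sgn G u v) refl
  where
  S : Fin _ → Bool
  S = movedAtoB′ side side′
  D : OrientedGraph _
  D = associated G side

  by-sign : ∀ m → sgn G u v ≡ m → push S D u v ≡ associated G side′ u v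
  by-sign nothing e = begin
    push S D u v            ≡⟨ push-absent S D (associated-nonedge G side e)
                                 (associated-nonedge G side (trans (symm G v u) e)) ⟩
    false                   ≡⟨ sym (associated-nonedge G side′ e) ⟩
    associated G side′ u v  ∎
  by-sign (just s) e = begin
    push S D u v                                       ≡⟨ push-reverses S D (associated-antisym G side e u≢v) ⟩
    (S u xor S v) xor D u v                            ≡⟨ cong₂ _xor_ (∧-not-xor-∧-not u≢v u≢′v)
                                                                      (associated-edge G side e u≢v) ⟩
    (side u xor side′ u) xor (side u xor negative s)   ≡⟨ xor-xor-cancelˡ (side u) (side′ u) (negative s) ⟩
    side′ u xor negative s                             ≡⟨ sym (associated-edge G side′ e u≢′v) ⟩
    associated G side′ u v                             ∎
    where
    u≢v : side u ≢ side v
    u≢v = bip u v s e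
    u≢′v : side′ u ≢ side′ v
    u≢′v = bip′ u v s e

mainTheorem9 : ∀ {n} (G : SignedGraph n) (side side' : Bipartition n)
    → IsBipartition G side → IsBipartition G side'
    → PushEquivalent (associated G side) (associated G side')
mainTheorem9 G side side' bip bip' =
  movedAtoB′ side side' , push-movedAtoB′-associated G side side' bip bip'
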